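{- Let $G=(V,E,W)$ be a finite connected edge-weighted graph (ties among edge weights allowed). Run Prim's algorithm on $G$ from some seed vertex $v_{seed}$ (with an arbitrary resolution of ties), producing a minimal spanning tree $T$ and a Prim's order $P$. Let $E_{max}$ be the set of edges of $T$ whose weight equals the maximum edge weight of $T$, and let $e_{max}=(v_i,v_j)\in E_{max}$ be the edge of $E_{max}$ with the largest Prim's order $P(e)$. Removing $e_{max}$ from $T$ splits $T$ into two subtrees. Then these two subtrees are $T_L=(V_L,E_L)$ and $T_R=(V_R,E_R)$, where \[ V_L=\{v\in V: P(v)<P(e_{max})\},\qquad V_R=\{v\in V: P(v)\ge P(e_{max})\}, \] \[ E_L=\{e \text{ edge of } T: P(e)<P(e_{max})\},\qquad E_R=\{e \text{ edge of } T: P(e)>P(e_{max})\}, \] with $P(e_{max})=\max(P(v_i),P(v_j))$.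
   Context: Prim's algorithm on a connected edge-weighted graph $G=(V,E,W)$: choose a seed vertex $v_{seed}$, set $V_{mst}=\{v_{seed}\}$, $E_{mst}=\emptyset$; while $V_{mst}\neq V$, pick an edge $(u,v)$ with $u\in V_{mst}$, $v\notin V_{mst}$ minimizing $W(u,v)$ (ties broken arbitrarily), and add $v$ to $V_{mst}$ and $(u,v)$ to $E_{mst}$. The output $(V,E_{mst})$ is a minimal spanning tree. The Prim's order is the order in which vertices are added to $V_{mst}$: $P(v)$ is the position of $v$, with $P(v_{seed})=1$. For an edge $e=(v_i,v_j)$ of the minimal spanning tree, $P(e)=\max(P(v_i),P(v_j))$. -}

module Defs where

open import Level using (Level; _⊔_; 0ℓ)
open import Data.Nat using (ℕ; zero; suc; _<_) renaming (_⊔_ to _⊔ℕ_)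
open import Data.Fin using (Fin; toℕ; zero; suc)
open import Data.Product using (Σ; _×_; _,_; ∃)
open import Data.Sum using (_⊎_)
open import Data.Unit using (⊤)
open import Relation.Nullary using (¬_)
open import Relation.Binary.PropositionalEquality using (_≡_; _≢_)
open import Relation.Binary.Bundles using (TotalOrder)

record WGraph {c ℓ₁ ℓ₂ : Level} (O : TotalOrder c ℓ₁ ℓ₂) (n m : ℕ) : Set c where
  field
    ends : Fin m → Fin n × Fin n
    w    : Fin m → TotalOrder.Carrier O

module _ {c ℓ₁ ℓ₂ : Level} {O : TotalOrder c ℓ₁ ℓ₂} {n m : ℕ} (G : WGraph O n m) where
  open WGraph G
  open TotalOrder O using () renaming (_≤_ to _≼_)

  Joins : Fin m → Fin n → Fin n → Set
  Joins e u v = (ends e ≡ (u , v)) ⊎ (ends e ≡ (v , u))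

  data Reach (Allowed : Fin m → Set) : Fin n → Fin n → Set where
    here : ∀ {u} → Reach Allowed u u
    step : ∀ {u v x} (e : Fin m) → Allowed e → Joins e u v → Reach Allowed v x → Reach Allowed u x

  Connected : Set
  Connected = ∀ u v → Reach (λ _ → ⊤) u v

-- A run of Prim's algorithm on G (n = suc k vertices) from seed vertex 'seed'.
--   order i : the vertex added at step i (step 0 = seed)
--   pos v   : the (0-based) step at which v is added; pos is inverse to order
--   parent t: the edge chosen at step (suc t): a minimum weight edge among
--             those with exactly one endpoint in V_mst = {v | pos v < suc t},
--             whose endpoint outside V_mst is the vertex order (suc t).
module _ {c ℓ₁ ℓ₂ : Level} {O : TotalOrder c ℓ₁ ℓ₂} {k m : ℕ} (G : WGraph O (suc k) m) where
  open WGraph G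
  open TotalOrder O using () renaming (_≤_ to _≼_)

  record PrimRun (seed : Fin (suc k)) : Set (c ⊔ ℓ₂) where
    field
      order     : Fin (suc k) → Fin (suc k)
      pos       : Fin (suc k) → Fin (suc k)
      pos-order : ∀ i → pos (order i) ≡ i
      order-pos : ∀ v → order (pos v) ≡ v
      order-seed : order zero ≡ seed
      parent    : Fin k → Fin m

    InMst : ℕ → Fin (suc k) → Set
    InMst i v = toℕ (pos v) < i

    Crosses : ℕ → Fin m → Set
    Crosses i e = Σ (Fin (suc k)) λ u → Σ (Fin (suc k)) λ v →
                    Joins G e u v × InMst i u × ¬ InMst i v

    field
      parent-valid : ∀ t → Σ (Fin (suc k)) λ u →
                       Joins G (parent t) u (order (suc t)) × InMst (toℕ (suc t)) u
      parent-min   : ∀ t e → Crosses (toℕ (suc t)) e → w (parent t) ≼ w e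

    P : Fin (suc k) → ℕ
    P v = suc (toℕ (pos v))

    Pₑ : Fin m → ℕ
    Pₑ e with ends e
    ... | (a , b) = P a ⊔ℕ P b

    InT : Fin m → Set
    InT e = ∃ λ t → parent t ≡ e

    BothEnds : (Fin (suc k) → Set) → Fin m → Set
    BothEnds Q e with ends e
    ... | (a , b) = Q a × Q b

-- Let e_max = parent t₀ be the maximum-weight tree edge with the largest
-- Prim order p = Pₑ e_max; it is the edge that added the vertex order (suc t₀),
-- so p = P (order (suc t₀)).  Every tree edge is  parent t, it joins an
-- earlier vertex to  order (suc t), and its Prim order is  P (order (suc t)).
--
--  * A tree edge with Pₑ e < p has both ends before p (true for any edge).
--  * A tree edge with Pₑ e > p has both ends at or after p: its earlier end u
--    cannot precede p, for then the edge would leave the first p - 1 vertices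
--    and Prim's choice of e_max would make it at least as heavy as e_max,
--    hence of maximal weight, contradicting the maximality of p.
--  * So every tree edge other than e_max stays on one side of the cut
--    {v | P v < p}, and walking from a vertex along its parent edges reaches
--    the seed (left side) or  order (suc t₀)  (right side) within its side.
module Submission where

open import Defs
open import Level using (Level)
open import Data.Nat using (ℕ; suc; zero; _<_; _≤_; _>_; _≥_; s≤s; _≤?_) renaming (_⊔_ to _⊔ℕ_)
open import Data.Nat.Properties hiding (_≟_)
open import Data.Fin using (Fin; toℕ; zero; suc)
open import Data.Fin.Properties using (toℕ-injective; _≟_) renaming (suc-injective to fsuc-injective)
open import Data.Product using (_×_; _,_; proj₁; proj₂)
open import Data.Sum using (_⊎_; inj₁; inj₂)
open import Data.Empty using (⊥-elim)
open import Function.Bundles using (_⇔_; mk⇔; Equivalence)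
open import Relation.Nullary using (¬_; Dec; yes; no; contradiction)
open import Relation.Binary.PropositionalEquality using (_≡_; refl; _≢_; sym; trans; cong; subst)
open import Relation.Binary.Bundles using (TotalOrder)
open import Relation.Binary.Definitions using (tri<; tri≈; tri>)

open Equivalence using (to; from)

module Paths {c ℓ₁ ℓ₂ : Level} {O : TotalOrder c ℓ₁ ℓ₂} {n m : ℕ} (G : WGraph O n m) where

  joins-sym : ∀ {e a b} → Joins G e a b → Joins G e b a
  joins-sym (inj₁ eq) = inj₂ eq
  joins-sym (inj₂ eq) = inj₁ eq

  module _ {A : Fin m → Set} where

    _++ᴿ_ : ∀ {u v x} → Reach G A u v → Reach G A v x → Reach G A u x
    here            ++ᴿ r′ = r′
    step e a j r    ++ᴿ r′ = step e a j (r ++ᴿ r′)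

    reverse : ∀ {u v} → Reach G A u v → Reach G A v u
    reverse here           = here
    reverse (step e a j r) = reverse r ++ᴿ step e a (joins-sym j) here

    preserved : (S : Fin n → Set) → (∀ e x y → A e → Joins G e x y → S x → S y) →
                ∀ {u v} → Reach G A u v → S u → S v
    preserved S closed here           su = su
    preserved S closed (step e a j r) su = preserved S closed r (closed e _ _ a j su)

    components-by-side :
      (S : Fin n → Set) → (∀ v → Dec (S v)) →
      (∀ e x y → A e → Joins G e x y → S x → S y) →
      (rS rN : Fin n) → (∀ v → S v → Reach G A v rS) → (∀ v → ¬ S v → Reach G A v rN) →
      ∀ u v → Reach G A u v ⇔ (S u ⇔ S v)
    components-by-side S S? closed rS rN toS toN u v = mk⇔ same-side connect
      where
        same-side : Reach G A u v → S u ⇔ S v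
        same-side r = mk⇔ (preserved S closed r) (preserved S closed (reverse r))

        connect : S u ⇔ S v → Reach G A u v
        connect h with S? u
        ... | yes su = toS u su ++ᴿ reverse (toS v (to h su))
        ... | no ¬su = toN u ¬su ++ᴿ reverse (toN v (λ sv → ¬su (from h sv)))

module PrimFacts {c ℓ₁ ℓ₂ : Level} {O : TotalOrder c ℓ₁ ℓ₂} {k m : ℕ}
                 {G : WGraph O (suc k) m} {seed : Fin (suc k)} (R : PrimRun G seed) where
  open WGraph G
  open TotalOrder O using () renaming (_≤_ to _≼_)
  open PrimRun R
  open Paths G

  V : Set
  V = Fin (suc k)

  P-order : ∀ i → P (order i) ≡ suc (toℕ i)
  P-order i = cong (λ j → suc (toℕ j)) (pos-order i)

  P-injective : ∀ {u v} → P u ≡ P v → u ≡ v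
  P-injective {u} {v} eq =
    trans (sym (order-pos u)) (trans (cong order (toℕ-injective (suc-injective eq))) (order-pos v))

  InMst-before : ∀ (s : Fin k) v → InMst (toℕ (suc s)) v ⇔ P v < P (order (suc s))
  InMst-before s v rewrite P-order (suc s) = mk⇔ s≤s ≤-pred

  bothEnds-joins : ∀ (Q : V → Set) {e a b} → Joins G e a b → BothEnds Q e ⇔ (Q a × Q b)
  bothEnds-joins Q (inj₁ eq) rewrite eq = mk⇔ (λ q → q) (λ q → q)
  bothEnds-joins Q (inj₂ eq) rewrite eq =
    mk⇔ (λ (qb , qa) → qa , qb) (λ (qa , qb) → qb , qa)

  Pₑ-joins : ∀ {e a b} → Joins G e a b → Pₑ e ≡ P a ⊔ℕ P b
  Pₑ-joins (inj₁ eq) rewrite eq = refl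
  Pₑ-joins {a = a} {b} (inj₂ eq) rewrite eq = ⊔-comm (P b) (P a)

  bothEnds-below : ∀ q e → BothEnds (λ v → P v < q) e ⇔ Pₑ e < q
  bothEnds-below q e with ends e
  ... | (a , b) = mk⇔ (λ (qa , qb) → ⊔-lub qa qb)
                      (λ lt → ≤-<-trans (m≤m⊔n (P a) (P b)) lt
                            , ≤-<-trans (m≤n⊔m (P a) (P b)) lt)

  bothEnds-above : ∀ q e → BothEnds (λ v → P v ≥ q) e → Pₑ e ≥ q
  bothEnds-above q e with ends e
  ... | (a , b) = λ (qa , _) → ≤-trans qa (m≤m⊔n (P a) (P b))

  parent-lightest : ∀ s e u v → Joins G e u v →
                    P u < P (order (suc s)) → ¬ (P v < P (order (suc s))) → w (parent s) ≼ w e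
  parent-lightest s e u v j u-in v-out =
    parent-min s e (u , v , j , from (InMst-before s u) u-in , λ v-in → v-out (to (InMst-before s v) v-in))

  Pₑ-parent : ∀ s → Pₑ (parent s) ≡ P (order (suc s))
  Pₑ-parent s with parent-valid s
  ... | u , j , u-in = trans (Pₑ-joins j) (m≤n⇒m⊔n≡n (<⇒≤ (to (InMst-before s u) u-in)))

  tree-Pₑ-injective : ∀ {e e′} → InT e → InT e′ → Pₑ e ≡ Pₑ e′ → e ≡ e′
  tree-Pₑ-injective (s , refl) (s′ , refl) eq =
    cong parent (fsuc-injective (trans (sym (pos-order (suc s)))
      (trans (cong pos (P-injective (trans (sym (Pₑ-parent s)) (trans eq (Pₑ-parent s′)))))
             (pos-order (suc s′)))))

  -- Following parent edges: if every vertex of S other than r was added by an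
  -- allowed edge whose earlier end is again in S, then all of S reaches r.
  -- (Induction on the Prim order, which strictly decreases along parents.)
  parent-descent :
    (A : Fin m → Set) (S : V → Set) (r : V) → (S (order zero) → order zero ≡ r) →
    (∀ s u → S (order (suc s)) → order (suc s) ≢ r →
       Joins G (parent s) u (order (suc s)) → InMst (toℕ (suc s)) u → A (parent s) × S u) →
    ∀ v → S v → Reach G A v r
  parent-descent A S r seed-case parent-case v sv =
    subst (λ x → Reach G A x r) (order-pos v)
      (descend (suc (toℕ (pos v))) (pos v) ≤-refl (subst S (sym (order-pos v)) sv))
    where
      descend : ∀ bound i → toℕ i < bound → S (order i) → Reach G A (order i) r
      descend (suc _) zero _ s0 = subst (Reach G A (order zero)) (seed-case s0) here
      descend (suc bound) (suc s) (s≤s lt) ss with order (suc s) ≟ r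
      ... | yes eq = subst (Reach G A (order (suc s))) eq here
      ... | no ne with parent-valid s
      ...   | u , j , u-in with parent-case s u ss ne j u-in
      ...     | a , su =
        step (parent s) a (joins-sym j)
          (subst (λ x → Reach G A x r) (order-pos u)
            (descend bound (pos u) (<-≤-trans u-in lt) (subst S (sym (order-pos u)) su)))

module MaxEdgeCut {c ℓ₁ ℓ₂ : Level} {O : TotalOrder c ℓ₁ ℓ₂} {k m : ℕ}
                  {G : WGraph O (suc k) m} {seed : Fin (suc k)} (R : PrimRun G seed) where
  open WGraph G
  open TotalOrder O using (_≈_; antisym) renaming (_≤_ to _≼_)
  open PrimRun R
  open PrimFacts R
  open Paths G

  module _ (t₀ : Fin k)
           (heaviest : ∀ e → InT e → w e ≼ w (parent t₀))
           (last-heaviest : ∀ e → InT e → w e ≈ w (parent t₀) → Pₑ e ≤ Pₑ (parent t₀)) where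

    emax : Fin m
    emax = parent t₀

    p : ℕ
    p = Pₑ emax

    Kept : Fin m → Set
    Kept e = InT e × e ≢ emax

    Left : V → Set
    Left v = P v < p

    -- The earlier end of a tree edge added after e_max does not precede p:
    -- otherwise the edge leaves V_mst at the step of e_max, so it weighs at
    -- least w e_max, hence exactly the maximum, and then its order exceeds p.
    later-parent-source : ∀ s u → p < P (order (suc s)) →
                          Joins G (parent s) u (order (suc s)) → P u ≥ p
    later-parent-source s u later j with p ≤? P u
    ... | yes p≤u = p≤u
    ... | no p≰u = contradiction (last-heaviest (parent s) (s , refl) tie) (<⇒≱ later′)
      where
        p≡ : p ≡ P (order (suc t₀))
        p≡ = Pₑ-parent t₀

        u-in : P u < P (order (suc t₀))
        u-in = subst (P u <_) p≡ (≰⇒> p≰u)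

        v-out : ¬ (P (order (suc s)) < P (order (suc t₀)))
        v-out lt = <-asym later (subst (P (order (suc s)) <_) (sym p≡) lt)

        tie : w (parent s) ≈ w emax
        tie = antisym (heaviest (parent s) (s , refl))
                      (parent-lightest t₀ (parent s) u (order (suc s)) j u-in v-out)

        later′ : p < Pₑ (parent s)
        later′ = subst (p <_) (sym (Pₑ-parent s)) later

    after-emax : ∀ s → p < Pₑ (parent s) → BothEnds (λ v → P v ≥ p) (parent s)
    after-emax s later with parent-valid s
    ... | u , j , _ =
      from (bothEnds-joins (λ v → P v ≥ p) j)
        (later-parent-source s u later′ j , <⇒≤ later′)
      where
        later′ : p < P (order (suc s))
        later′ = subst (p <_) (Pₑ-parent s) later

    kept-sides : ∀ e → Kept e → BothEnds Left e ⊎ BothEnds (λ v → P v ≥ p) e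
    kept-sides e ((s , refl) , ne) with <-cmp (Pₑ (parent s)) p
    ... | tri< lt _ _ = inj₁ (from (bothEnds-below p (parent s)) lt)
    ... | tri≈ _ eq _ = ⊥-elim (ne (tree-Pₑ-injective (s , refl) (t₀ , refl) eq))
    ... | tri> _ _ gt = inj₂ (after-emax s gt)

    kept-closed : ∀ e x y → Kept e → Joins G e x y → Left x → Left y
    kept-closed e x y kept j left-x with kept-sides e kept
    ... | inj₁ both = proj₂ (to (bothEnds-joins Left j) both)
    ... | inj₂ both = contradiction (proj₁ (to (bothEnds-joins (λ v → P v ≥ p) j) both)) (<⇒≱ left-x)

    left-to-seed : ∀ v → Left v → Reach G Kept v (order zero)
    left-to-seed = parent-descent Kept Left (order zero) (λ _ → refl) parent-case
      where
        parent-case : ∀ s u → Left (order (suc s)) → order (suc s) ≢ order zero →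
                      Joins G (parent s) u (order (suc s)) → InMst (toℕ (suc s)) u →
                      Kept (parent s) × Left u
        parent-case s u left _ _ u-in =
          ((s , refl) , λ eq → <-irrefl (trans (sym (Pₑ-parent s)) (cong Pₑ eq)) left)
          , <-trans (to (InMst-before s u) u-in) left

    right-to-root : ∀ v → ¬ Left v → Reach G Kept v (order (suc t₀))
    right-to-root v ¬left = parent-descent Kept (λ x → P x ≥ p) (order (suc t₀))
      seed-case parent-case v (≮⇒≥ ¬left)
      where
        p≡ : p ≡ P (order (suc t₀))
        p≡ = Pₑ-parent t₀

        seed-case : P (order zero) ≥ p → order zero ≡ order (suc t₀)
        seed-case ge rewrite p≡ | P-order (suc t₀) | P-order zero = contradiction ge λ { (s≤s ()) }

        parent-case : ∀ s u → P (order (suc s)) ≥ p → order (suc s) ≢ order (suc t₀) →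
                      Joins G (parent s) u (order (suc s)) → InMst (toℕ (suc s)) u →
                      Kept (parent s) × P u ≥ p
        parent-case s u ge ne j _ = ((s , refl) , kept) , later-parent-source s u later j
          where
            later : p < P (order (suc s))
            later = ≤∧≢⇒< ge (λ eq → ne (P-injective (trans (sym eq) p≡)))

            kept : parent s ≢ emax
            kept eq = <-irrefl (trans (sym (cong Pₑ eq)) (Pₑ-parent s)) later

    components : ∀ u v → Reach G Kept u v ⇔ (Left u ⇔ Left v)
    components = components-by-side Left (λ v → suc (P v) ≤? p) kept-closed
                   (order zero) (order (suc t₀)) left-to-seed right-to-root

    kept-edge-sides : ∀ e → InT e → e ≢ emax →
                      (BothEnds Left e ⇔ Pₑ e < p) × (BothEnds (λ v → P v ≥ p) e ⇔ Pₑ e > p)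
    kept-edge-sides e (s , refl) ne =
      bothEnds-below p (parent s) , mk⇔ right⇒above above⇒right
      where
        right⇒above : BothEnds (λ v → P v ≥ p) (parent s) → Pₑ (parent s) > p
        right⇒above both = ≤∧≢⇒< (bothEnds-above p (parent s) both)
                              (λ eq → ne (sym (tree-Pₑ-injective (t₀ , refl) (s , refl) eq)))

        above⇒right : Pₑ (parent s) > p → BothEnds (λ v → P v ≥ p) (parent s)
        above⇒right = after-emax s

-- The hypotheses say emax = parent t₀ is the last heaviest tree edge.
proposition2 : ∀ {c ℓ₁ ℓ₂ : Level} (O : TotalOrder c ℓ₁ ℓ₂) {k m : ℕ}
    (G : WGraph O (suc k) m) → Connected G →
    (seed : Fin (suc k)) (R : PrimRun G seed) →
    let open WGraph G
        open TotalOrder O using (_≈_) renaming (_≤_ to _≼_)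
        open PrimRun R
    in (emax : Fin m) → InT emax →
       (∀ e → InT e → w e ≼ w emax) →
       (∀ e → InT e → w e ≈ w emax → Pₑ e ≤ Pₑ emax) →
       ((∀ u v → Reach G (λ e → InT e × e ≢ emax) u v ⇔ (P u < Pₑ emax ⇔ P v < Pₑ emax))
        × (∀ e → InT e → e ≢ emax →
             (BothEnds (λ v → P v < Pₑ emax) e ⇔ Pₑ e < Pₑ emax)
             × (BothEnds (λ v → P v ≥ Pₑ emax) e ⇔ Pₑ e > Pₑ emax)))
proposition2 O G _ seed R .(PrimRun.parent R t₀) (t₀ , refl) heaviest last-heaviest =
  components t₀ heaviest last-heaviest , kept-edge-sides t₀ heaviest last-heaviest
  where open MaxEdgeCut R
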